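{- For the cycle $C_n$ of order $n\geq 3$, \[ \chi_d^t(C(C_n))=\begin{cases}\lfloor 2n/3\rfloor +1 & \text{if } n\equiv 0 \pmod 3 \text{ and } n\neq 3,\\ \lfloor 2n/3\rfloor +2 & \text{otherwise}.\end{cases} \]
   Context: For a graph $G=(V,E)$ with $V=\{v_1,\dots,v_n\}$, the central graph $C(G)$ is the graph with vertex set $V\cup\{c_{ij} : v_iv_j\in E\}$ obtained by subdividing each edge $v_iv_j$ of $G$ exactly once by a new vertex $c_{ij}$ (adjacent to exactly $v_i$ and $v_j$) and joining every pair of distinct vertices non-adjacent in $G$. A total dominator coloring (TDC) of a graph $H$ with no isolated vertices is a proper vertex coloring of $H$ in which every vertex is adjacent to all vertices of some color class. $\chi_d^t(H)$ is the minimum number of color classes in a TDC of $H$. -}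

module Defs where

open import Data.Nat using (ℕ; zero; suc; _+_; _*_; _<_; _≡ᵇ_)
open import Data.Nat.DivMod using (_/_; _%_)
open import Data.Bool using (Bool; true; false; _∨_; _∧_; not; if_then_else_)
open import Data.Fin using (Fin; toℕ)
open import Data.Product using (Σ; _×_; _,_; ∃)
open import Data.Sum using (_⊎_; inj₁; inj₂)
open import Data.Empty using (⊥)
open import Function using (Surjective)
open import Relation.Binary.PropositionalEquality using (_≡_; _≢_)

record Graph (n : ℕ) : Set where
  field
    adj : Fin n → Fin n → Bool
    adj-sym : ∀ i j → adj i j ≡ adj j i
    adj-irrefl : ∀ i → adj i i ≡ false
open Graph public

cycleAdj : (n : ℕ) → Fin n → Fin n → Bool
cycleAdj n i j =
  (toℕ j ≡ᵇ suc (toℕ i)) ∨ (toℕ i ≡ᵇ suc (toℕ j))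
  ∨ ((toℕ i ≡ᵇ 0) ∧ (suc (toℕ j) ≡ᵇ n))
  ∨ ((toℕ j ≡ᵇ 0) ∧ (suc (toℕ i) ≡ᵇ n))

Edge : ∀ {n} → Graph n → Set
Edge {n} G = Σ (Fin n × Fin n) λ { (i , j) → (toℕ i < toℕ j) × (adj G i j ≡ true) }

-- Vertices of the central graph C(G): original vertices plus one subdivision vertex per edge.
CVertex : ∀ {n} → Graph n → Set
CVertex {n} G = Fin n ⊎ Edge G

CAdj : ∀ {n} (G : Graph n) → CVertex G → CVertex G → Set
CAdj G (inj₁ i) (inj₁ j) = (i ≢ j) × (adj G i j ≡ false)
CAdj G (inj₁ k) (inj₂ ((i , j) , _)) = (k ≡ i) ⊎ (k ≡ j)
CAdj G (inj₂ ((i , j) , _)) (inj₁ k) = (k ≡ i) ⊎ (k ≡ j)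
CAdj G (inj₂ _) (inj₂ _) = ⊥

-- A total dominator coloring of a graph (W, A) with exactly k (nonempty) color classes:
-- a surjective proper coloring c : W → Fin k such that every vertex is adjacent to
-- every vertex of some color class.
IsTDC : {W : Set} (A : W → W → Set) (k : ℕ) (c : W → Fin k) → Set
IsTDC {W} A k c =
  Surjective _≡_ _≡_ c
  × (∀ u v → A u v → c u ≢ c v)
  × (∀ v → ∃ λ (col : Fin k) → ∀ u → c u ≡ col → A v u)

HasTDC : {W : Set} (A : W → W → Set) (k : ℕ) → Set
HasTDC {W} A k = Σ (W → Fin k) λ c → IsTDC A k c

TotalDomChromaticNumberIs : {W : Set} (A : W → W → Set) (k : ℕ) → Set
TotalDomChromaticNumberIs A k = HasTDC A k × (∀ m → HasTDC A m → k Data.Nat.≤ m)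

expectedValue : ℕ → ℕ
expectedValue n =
  if (n % 3 ≡ᵇ 0) ∧ not (n ≡ᵇ 3) then (2 * n) / 3 + 1 else (2 * n) / 3 + 2

-- In a TDC of C(Cₙ) the class dominated by the subdivision vertex of an edge {i , i + 1}
-- consists of vertices among i and i + 1, and equally coloured vertices are adjacent in Cₙ, so for
-- n ≥ 4 a vertex colour class is a single vertex or two consecutive ones. Giving every colour three
-- slots, vertices and these dominated classes occupy 2n distinct slots and three slots of colours of
-- subdivision vertices stay free, whence 3χ ≥ 2n + 3. For n = 3 a vertex is adjacent only to
-- subdivision vertices, so the classes dominated by vertices give two colours beyond the two
-- dominated by subdivision vertices. For n ≥ 6 colour vertex j by ⌊(2j + 1)/3⌋ and all subdivision vertices by one more
-- colour: a vertex dominates the singleton class of 0 or of 3, and a subdivision vertex the class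
-- of one of its ends. For n ≤ 5 explicit colourings are checked by evaluation.

module Submission where

open import Defs
open import Data.Bool using (Bool; true; false; _∨_; _∧_; if_then_else_)
open import Data.Bool.Properties using (T-≡; T-∨; T-∧; ¬-not; ∨-zeroʳ) renaming (_≟_ to _≟ᵇ_)
open import Data.Empty using (⊥; ⊥-elim)
open import Data.Fin using (Fin; zero; suc; toℕ; lower₁; fromℕ; fromℕ<)
open import Data.Fin.Properties using (toℕ-injective; toℕ<n; toℕ-lower₁; toℕ-fromℕ; toℕ-fromℕ<; +↔⊎; *↔×; injective⇒≤; any?; all?)
  renaming (<-cmp to <-cmpᶠ; _≟_ to _≟ᶠ_)
open import Data.Nat using (ℕ; zero; suc; _+_; _*_; _≤_; _<_; z≤n; s≤s; _≡ᵇ_; _<?_)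
open import Data.Nat.Properties
  using (≡ᵇ⇒≡; ≡⇒≡ᵇ; suc-injective; <-irrefl; +-suc; +-identityʳ; +-cancelˡ-≡; +-mono-≤-<; <⇒≢; <⇒≤; ≤-trans; ≤-pred; n≤1+n; ≤-refl; ≤-reflexive; m≤n⇒m<n∨m≡n; m≤n⇒m≤1+n; *-distribˡ-+; +-monoʳ-≤; ≤∧≢⇒<; n≮0; <-asym; n<1+n; *-cancelˡ-<; +-monoˡ-≤; +-comm; *-comm; module ≤-Reasoning)
  renaming (_≟_ to _≟ℕ_)
open import Data.Nat.DivMod using (_/_; +-distrib-/-∣ˡ)
open import Data.Nat.Divisibility using (divides)
open import Data.Nat.Tactic.RingSolver using (solve-∀)
open import Data.Product using (Σ; _×_; _,_; ∃; proj₁; proj₂; uncurry)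
open import Data.Sum using (_⊎_; inj₁; inj₂; [_,_])
import Data.Sum as Sum
open import Data.Sum.Function.Propositional using (_⊎-↔_)
open import Function using (_∘_; case_of_; Equivalence; Injection; Injective; _↔_; _↣_; mk↣)
open import Function.Construct.Composition using (_↣-∘_; _↔-∘_)
open import Function.Properties.Inverse using (↔⇒↣; ↔-sym; ↔-refl)
open import Relation.Binary using (tri<; tri≈; tri>)
open import Relation.Binary.PropositionalEquality using (_≡_; _≢_; refl; sym; trans; cong; subst)
open import Relation.Nullary using (¬_; Dec; yes; no)
open import Relation.Nullary.Decidable using (from-yes; ¬?; _→-dec_; _×-dec_; _⊎-dec_; map′)

open Equivalence using (to; from)

≡ᵇ-true : ∀ {a b} → a ≡ b → (a ≡ᵇ b) ≡ true
≡ᵇ-true {a} {b} p = T-≡ .to (≡⇒≡ᵇ a b p)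

-- Cycle adjacency

data CyclicSucc (n a b : ℕ) : Set where
  step : b ≡ suc a → CyclicSucc n a b
  wrap : suc a ≡ n → b ≡ 0 → CyclicSucc n a b

CycleNeighbours : (n a b : ℕ) → Set
CycleNeighbours n a b = CyclicSucc n a b ⊎ CyclicSucc n b a

cycleAdj⇒CycleNeighbours : ∀ n (i j : Fin n) → cycleAdj n i j ≡ true → CycleNeighbours n (toℕ i) (toℕ j)
cycleAdj⇒CycleNeighbours n i j adj with T-∨ .to (T-≡ .from adj)
... | inj₁ j≡1+i = inj₁ (step (≡ᵇ⇒≡ _ _ j≡1+i))
... | inj₂ rest with T-∨ .to rest
...   | inj₁ i≡1+j = inj₂ (step (≡ᵇ⇒≡ _ _ i≡1+j))
...   | inj₂ rest′ with T-∨ .to rest′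
...     | inj₁ wrapped = let (i≡0 , 1+j≡n) = T-∧ .to wrapped in inj₂ (wrap (≡ᵇ⇒≡ _ _ 1+j≡n) (≡ᵇ⇒≡ _ _ i≡0))
...     | inj₂ wrapped = let (j≡0 , 1+i≡n) = T-∧ .to wrapped in inj₁ (wrap (≡ᵇ⇒≡ _ _ 1+i≡n) (≡ᵇ⇒≡ _ _ j≡0))

∨-introˡ : ∀ {x} y → x ≡ true → (x ∨ y) ≡ true
∨-introˡ _ refl = refl

∨-introʳ : ∀ x {y} → y ≡ true → (x ∨ y) ≡ true
∨-introʳ x refl = ∨-zeroʳ x

∧-intro : ∀ {x y} → x ≡ true → y ≡ true → (x ∧ y) ≡ true
∧-intro refl refl = refl

CycleNeighbours⇒cycleAdj : ∀ n (i j : Fin n) → CycleNeighbours n (toℕ i) (toℕ j) → cycleAdj n i j ≡ true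
CycleNeighbours⇒cycleAdj n i j (inj₁ (step p)) = ∨-introˡ _ (≡ᵇ-true p)
CycleNeighbours⇒cycleAdj n i j (inj₂ (step p)) = ∨-introʳ (toℕ j ≡ᵇ suc (toℕ i)) (∨-introˡ _ (≡ᵇ-true p))
CycleNeighbours⇒cycleAdj n i j (inj₂ (wrap p q)) =
  ∨-introʳ (toℕ j ≡ᵇ suc (toℕ i)) (∨-introʳ (toℕ i ≡ᵇ suc (toℕ j)) (∨-introˡ _ (∧-intro (≡ᵇ-true q) (≡ᵇ-true p))))
CycleNeighbours⇒cycleAdj n i j (inj₁ (wrap p q)) =
  ∨-introʳ (toℕ j ≡ᵇ suc (toℕ i)) (∨-introʳ (toℕ i ≡ᵇ suc (toℕ j))
    (∨-introʳ ((toℕ i ≡ᵇ 0) ∧ (suc (toℕ j) ≡ᵇ n)) (∧-intro (≡ᵇ-true q) (≡ᵇ-true p))))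

¬CycleNeighbours⇒cycleAdj : ∀ n (i j : Fin n) → ¬ CycleNeighbours n (toℕ i) (toℕ j) → cycleAdj n i j ≡ false
¬CycleNeighbours⇒cycleAdj n i j ¬nb = ¬-not (¬nb ∘ cycleAdj⇒CycleNeighbours n i j)

cyclicSucc-functional : ∀ {n a b b′} → b < n → b′ < n → CyclicSucc n a b → CyclicSucc n a b′ → b ≡ b′
cyclicSucc-functional _ _ (step p) (step q) = trans p (sym q)
cyclicSucc-functional _ _ (wrap _ p) (wrap _ q) = trans p (sym q)
cyclicSucc-functional b<n _ (step p) (wrap 1+a≡n _) = ⊥-elim (<-irrefl (trans p 1+a≡n) b<n)
cyclicSucc-functional _ b′<n (wrap 1+a≡n _) (step q) = ⊥-elim (<-irrefl (trans q 1+a≡n) b′<n)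

cyclicSucc-injective : ∀ {n a a′ b} → CyclicSucc n a b → CyclicSucc n a′ b → a ≡ a′
cyclicSucc-injective (step p) (step q) = suc-injective (trans (sym p) q)
cyclicSucc-injective (wrap p _) (wrap q _) = suc-injective (trans p (sym q))
cyclicSucc-injective (step p) (wrap _ q) with trans (sym q) p
... | ()
cyclicSucc-injective (wrap _ p) (step q) with trans (sym p) q
... | ()

next : ∀ {k} → Fin (suc k) → Fin (suc k)
next {k} i with k ≟ℕ toℕ i
... | yes _ = zero
... | no k≢i = suc (lower₁ i k≢i)

next-cyclicSucc : ∀ {k} (i : Fin (suc k)) → CyclicSucc (suc k) (toℕ i) (toℕ (next i))
next-cyclicSucc {k} i with k ≟ℕ toℕ i
... | yes k≡i = wrap (cong suc (sym k≡i)) refl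
... | no k≢i = step (cong suc (toℕ-lower₁ i k≢i))

cyclicSucc⇒next : ∀ {k} {i j : Fin (suc k)} → CyclicSucc (suc k) (toℕ i) (toℕ j) → j ≡ next i
cyclicSucc⇒next {i = i} {j} s =
  toℕ-injective (cyclicSucc-functional (toℕ<n j) (toℕ<n (next i)) s (next-cyclicSucc i))

next-injective : ∀ {k} {i j : Fin (suc k)} → next i ≡ next j → i ≡ j
next-injective {i = i} {j} eq = toℕ-injective (cyclicSucc-injective (next-cyclicSucc i) j↦next-i)
  where
  j↦next-i : CyclicSucc _ (toℕ j) (toℕ (next i))
  j↦next-i = subst (CyclicSucc _ (toℕ j) ∘ toℕ) (sym eq) (next-cyclicSucc j)

next^ : ∀ {k} → ℕ → Fin (suc k) → Fin (suc k)
next^ zero i = i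
next^ (suc r) i = next (next^ r i)

toℕ-next^ : ∀ {k} r → r ≤ k → (i : Fin (suc k)) →
  toℕ (next^ r i) ≡ toℕ i + r ⊎ toℕ (next^ r i) + suc k ≡ toℕ i + r
toℕ-next^ zero _ i = inj₁ (sym (+-identityʳ (toℕ i)))
toℕ-next^ {k} (suc r) r<k i with toℕ-next^ r (<⇒≤ r<k) i | next-cyclicSucc (next^ r i)
... | inj₁ p | step q = inj₁ (trans q (trans (cong suc p) (sym (+-suc (toℕ i) r))))
... | inj₁ p | wrap 1+t≡n q =
  inj₂ (trans (cong (_+ suc k) q) (trans (sym 1+t≡n) (trans (cong suc p) (sym (+-suc (toℕ i) r)))))
... | inj₂ p | step q = inj₂ (trans (cong (_+ suc k) q) (trans (cong suc p) (sym (+-suc (toℕ i) r))))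
... | inj₂ p | wrap 1+t≡n _ = ⊥-elim (<-irrefl (sym p) (+-mono-≤-< i≤t (≤-trans r<k (n≤1+n k))))
  where
  i≤t : toℕ i ≤ toℕ (next^ r i)
  i≤t = subst (toℕ i ≤_) (suc-injective (sym 1+t≡n)) (≤-pred (toℕ<n i))

next^≢ : ∀ {k} r → 1 ≤ r → r ≤ k → (i : Fin (suc k)) → next^ r i ≢ i
next^≢ r 1≤r r≤k i eq with toℕ-next^ r r≤k i
... | inj₁ p = <⇒≢ 1≤r (sym (+-cancelˡ-≡ (toℕ i) r 0 (trans (sym p) (trans (cong toℕ eq) (sym (+-identityʳ _))))))
... | inj₂ p = <⇒≢ (s≤s r≤k) (sym (+-cancelˡ-≡ (toℕ i) _ _ (trans (sym (cong (λ x → toℕ x + _) eq)) p)))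

cycleAdj-next : ∀ {k} (i : Fin (suc k)) → cycleAdj (suc k) i (next i) ≡ true
cycleAdj-next i = CycleNeighbours⇒cycleAdj _ i (next i) (inj₁ (next-cyclicSucc i))

cycleAdj⇒next : ∀ {k} {i j : Fin (suc k)} → cycleAdj (suc k) i j ≡ true → j ≡ next i ⊎ i ≡ next j
cycleAdj⇒next {i = i} {j} adj = Sum.map cyclicSucc⇒next cyclicSucc⇒next (cycleAdj⇒CycleNeighbours _ i j adj)

↣⇒≤ : ∀ {a b} {A B : Set} → Fin a ↔ A → A ↣ B → Fin b ↔ B → a ≤ b
↣⇒≤ a↔A A↣B b↔B = injective⇒≤ (Injection.injective (↔⇒↣ (↔-sym b↔B) ↣-∘ (A↣B ↣-∘ ↔⇒↣ a↔A)))

[,]-injective : ∀ {A B C : Set} {f : A → C} {g : B → C} →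
  Injective _≡_ _≡_ f → Injective _≡_ _≡_ g → (∀ x y → f x ≢ g y) → Injective _≡_ _≡_ [ f , g ]
[,]-injective f-inj _ _ {inj₁ x} {inj₁ x′} eq = cong inj₁ (f-inj eq)
[,]-injective _ g-inj _ {inj₂ y} {inj₂ y′} eq = cong inj₂ (g-inj eq)
[,]-injective _ _ disjoint {inj₁ x} {inj₂ y} eq = ⊥-elim (disjoint x y eq)
[,]-injective _ _ disjoint {inj₂ y} {inj₁ x} eq = ⊥-elim (disjoint x y (sym eq))

pattern one = suc zero
pattern two = suc (suc zero)

injective₂ : ∀ {A : Set} {h : Fin 2 → A} → h zero ≢ h one → Injective _≡_ _≡_ h
injective₂ _ {zero} {zero} _ = refl
injective₂ _ {one} {one} _ = refl
injective₂ h₀≢h₁ {zero} {one} eq = ⊥-elim (h₀≢h₁ eq)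
injective₂ h₀≢h₁ {one} {zero} eq = ⊥-elim (h₀≢h₁ (sym eq))

injective₃ : ∀ {A : Set} {h : Fin 3 → A} → h zero ≢ h one → h zero ≢ h two → h one ≢ h two → Injective _≡_ _≡_ h
injective₃ _ _ _ {zero} {zero} _ = refl
injective₃ _ _ _ {one} {one} _ = refl
injective₃ _ _ _ {two} {two} _ = refl
injective₃ h₀≢h₁ _ _ {zero} {one} eq = ⊥-elim (h₀≢h₁ eq)
injective₃ h₀≢h₁ _ _ {one} {zero} eq = ⊥-elim (h₀≢h₁ (sym eq))
injective₃ _ h₀≢h₂ _ {zero} {two} eq = ⊥-elim (h₀≢h₂ eq)
injective₃ _ h₀≢h₂ _ {two} {zero} eq = ⊥-elim (h₀≢h₂ (sym eq))
injective₃ _ _ h₁≢h₂ {one} {two} eq = ⊥-elim (h₁≢h₂ eq)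
injective₃ _ _ h₁≢h₂ {two} {one} eq = ⊥-elim (h₁≢h₂ (sym eq))

-- Central graphs

edgeBetween : ∀ {n} (G : Graph n) (i j : Fin n) → i ≢ j → adj G i j ≡ true → Edge G
edgeBetween G i j i≢j ij with <-cmpᶠ i j
... | tri< i<j _ _ = (i , j) , i<j , ij
... | tri≈ _ i≡j _ = ⊥-elim (i≢j i≡j)
... | tri> _ _ j<i = (j , i) , j<i , trans (adj-sym G j i) ij

edgeBetween-ends : ∀ {n} (G : Graph n) {i j l : Fin n} (i≢j : i ≢ j) (ij : adj G i j ≡ true) →
  CAdj G (inj₂ (edgeBetween G i j i≢j ij)) (inj₁ l) → l ≡ i ⊎ l ≡ j
edgeBetween-ends G {i} {j} i≢j ij with <-cmpᶠ i j
... | tri< _ _ _ = λ ends → ends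
... | tri≈ _ i≡j _ = ⊥-elim (i≢j i≡j)
... | tri> _ _ _ = Sum.swap

edgeBetween-endˡ : ∀ {n} (G : Graph n) {i j : Fin n} (i≢j : i ≢ j) (ij : adj G i j ≡ true) →
  CAdj G (inj₂ (edgeBetween G i j i≢j ij)) (inj₁ i)
edgeBetween-endˡ G {i} {j} i≢j ij with <-cmpᶠ i j
... | tri< _ _ _ = inj₁ refl
... | tri≈ _ i≡j _ = ⊥-elim (i≢j i≡j)
... | tri> _ _ _ = inj₂ refl

module CentralTDC {n m} (G : Graph n) (c : CVertex G → Fin m) (tdc : IsTDC (CAdj G) m c) where

  proper : ∀ u v → CAdj G u v → c u ≢ c v
  proper = proj₁ (proj₂ tdc)

  sameColour⇒adj : ∀ {i j} → i ≢ j → c (inj₁ i) ≡ c (inj₁ j) → adj G i j ≡ true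
  sameColour⇒adj {i} {j} i≢j same = ¬-not (λ nonadj → proper (inj₁ i) (inj₁ j) (i≢j , nonadj) same)

  dominated : CVertex G → Fin m
  dominated v = proj₁ (proj₂ (proj₂ tdc) v)

  dominated-adj : ∀ {v u} → c u ≡ dominated v → CAdj G v u
  dominated-adj {v} {u} = proj₂ (proj₂ (proj₂ tdc) v) u

  dominated-inhabited : ∀ v → ∃ λ u → c u ≡ dominated v
  dominated-inhabited v = let (u , hit) = proj₁ tdc (dominated v) in u , hit refl

  edgeClass-vertex : ∀ e → ∃ λ l → c (inj₁ l) ≡ dominated (inj₂ e)
  edgeClass-vertex e with dominated-inhabited (inj₂ e)
  ... | inj₁ l , hit = l , hit
  ... | inj₂ _ , hit = ⊥-elim (dominated-adj hit)

  edgeColour≢edgeClass : ∀ e e′ → c (inj₂ e′) ≢ dominated (inj₂ e)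
  edgeColour≢edgeClass _ _ = dominated-adj

module CycleTDC {k m} (1≤k : 1 ≤ k) (cyc : Graph (suc k)) (hyp : ∀ i j → adj cyc i j ≡ cycleAdj (suc k) i j)
                (c : CVertex cyc → Fin m) (tdc : IsTDC (CAdj cyc) m c) where
  open CentralTDC cyc c tdc public

  next≢ : ∀ i → next i ≢ i
  next≢ = next^≢ 1 ≤-refl 1≤k

  cycleEdge : Fin (suc k) → Edge cyc
  cycleEdge i = edgeBetween cyc i (next i) (next≢ i ∘ sym) (trans (hyp i (next i)) (cycleAdj-next i))

  colour : Fin (suc k) → Fin m
  colour j = c (inj₁ j)

  edgeClass : Fin (suc k) → Fin m
  edgeClass i = dominated (inj₂ (cycleEdge i))

  edgeClass-member : ∀ i {l} → colour l ≡ edgeClass i → l ≡ i ⊎ l ≡ next i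
  edgeClass-member i hit = edgeBetween-ends cyc (next≢ i ∘ sym) _ (dominated-adj hit)

  edgeClass-inhabited : ∀ i → ∃ λ l → colour l ≡ edgeClass i
  edgeClass-inhabited i = edgeClass-vertex (cycleEdge i)

  sameColour⇒consecutive : ∀ {j l} → j ≢ l → colour j ≡ colour l → l ≡ next j ⊎ j ≡ next l
  sameColour⇒consecutive {j} {l} j≢l same = cycleAdj⇒next (trans (sym (hyp j l)) (sameColour⇒adj j≢l same))

-- Lower bounds

vertexBit : ∀ {A : Set} → Dec A → Fin 3
vertexBit (yes _) = one
vertexBit (no _) = zero

edgeBit : ∀ {A : Set} → Dec A → Fin 3
edgeBit (yes _) = two
edgeBit (no _) = one

module SlotCounting {k m} (3≤k : 3 ≤ k) (cyc : Graph (suc k))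
                    (hyp : ∀ i j → adj cyc i j ≡ cycleAdj (suc k) i j)
                    (c : CVertex cyc → Fin m) (tdc : IsTDC (CAdj cyc) m c) where
  open CycleTDC (≤-trans (s≤s z≤n) 3≤k) cyc hyp c tdc

  next²≢ : ∀ i → next (next i) ≢ i
  next²≢ = next^≢ 2 (s≤s z≤n) (≤-trans (s≤s (s≤s z≤n)) 3≤k)

  next³≢ : ∀ i → next (next (next i)) ≢ i
  next³≢ = next^≢ 3 (s≤s z≤n) 3≤k

  no-three-consecutive : ∀ j → colour j ≡ colour (next j) → colour (next j) ≡ colour (next (next j)) → ⊥
  no-three-consecutive j p q with sameColour⇒consecutive (next²≢ j ∘ sym) (trans p q)
  ... | inj₁ next²≡next = next≢ (next j) next²≡next
  ... | inj₂ j≡next³ = next³≢ j (sym j≡next³)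

  edgeClass-self : ∀ i → colour (next i) ≢ edgeClass i → colour i ≡ edgeClass i
  edgeClass-self i next∉ with edgeClass-inhabited i
  ... | l , hit with edgeClass-member i hit
  ...   | inj₁ refl = hit
  ...   | inj₂ refl = ⊥-elim (next∉ hit)

  vertexSlot : Fin (suc k) → Fin m × Fin 3
  vertexSlot j = colour j , vertexBit (colour (next j) ≟ᶠ colour j)

  edgeSlot : Fin (suc k) → Fin m × Fin 3
  edgeSlot i = edgeClass i , edgeBit (colour (next i) ≟ᶠ edgeClass i)

  vertexSlot-next : ∀ j → vertexSlot j ≢ vertexSlot (next j)
  vertexSlot-next j eq
    with colour (next j) ≟ᶠ colour j | colour (next (next j)) ≟ᶠ colour (next j) | cong proj₂ eq
  ... | yes p | yes q | _ = no-three-consecutive j (sym p) (sym q)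
  ... | no next≢j | _ | _ = next≢j (sym (cong proj₁ eq))
  ... | yes _ | no _ | ()

  vertexSlot-injective : Injective _≡_ _≡_ vertexSlot
  vertexSlot-injective {j} {l} eq with j ≟ᶠ l
  ... | yes j≡l = j≡l
  ... | no j≢l with sameColour⇒consecutive j≢l (cong proj₁ eq)
  ...   | inj₁ refl = ⊥-elim (vertexSlot-next j eq)
  ...   | inj₂ refl = ⊥-elim (vertexSlot-next l (sym eq))

  edgeSlot-injective : Injective _≡_ _≡_ edgeSlot
  edgeSlot-injective {i} {l} eq
    with colour (next i) ≟ᶠ edgeClass i | colour (next l) ≟ᶠ edgeClass l | cong proj₂ eq
  ... | yes p | yes q | _ with edgeClass-member i (trans q (sym (cong proj₁ eq)))
  ...   | inj₂ next-l≡next-i = sym (next-injective next-l≡next-i)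
  ...   | inj₁ next-l≡i with edgeClass-member l (trans p (cong proj₁ eq))
  ...     | inj₂ next-i≡next-l = next-injective next-i≡next-l
  ...     | inj₁ refl = ⊥-elim (next²≢ i next-l≡i)
  edgeSlot-injective {i} {l} eq | no p | no q | _
    with edgeClass-member i (trans (edgeClass-self l q) (sym (cong proj₁ eq)))
  ... | inj₁ l≡i = sym l≡i
  ... | inj₂ refl = ⊥-elim (p (trans (edgeClass-self l q) (sym (cong proj₁ eq))))
  edgeSlot-injective eq | yes _ | no _ | ()
  edgeSlot-injective eq | no _ | yes _ | ()

  vertexSlot≢edgeSlot : ∀ j i → vertexSlot j ≢ edgeSlot i
  vertexSlot≢edgeSlot j i eq
    with colour (next j) ≟ᶠ colour j | colour (next i) ≟ᶠ edgeClass i | cong proj₂ eq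
  ... | yes p | no q | _ with edgeClass-member i (cong proj₁ eq)
  ...   | inj₁ refl = q (trans p (cong proj₁ eq))
  ...   | inj₂ refl = q (cong proj₁ eq)
  vertexSlot≢edgeSlot j i eq | yes _ | yes _ | ()
  vertexSlot≢edgeSlot j i eq | no _ | yes _ | ()
  vertexSlot≢edgeSlot j i eq | no _ | no _ | ()

  vertexSlot≢edgeColour : ∀ j e → vertexSlot j ≢ (c (inj₂ e) , one)
  vertexSlot≢edgeColour j e eq with colour (next j) ≟ᶠ colour j | cong proj₂ eq
  ... | no _ | ()
  ... | yes p | _ with edgeClass-inhabited j
  ...   | l , hit with edgeClass-member j hit
  ...     | inj₁ refl = edgeColour≢edgeClass (cycleEdge l) e (trans (sym (cong proj₁ eq)) hit)
  ...     | inj₂ refl = edgeColour≢edgeClass (cycleEdge j) e (trans (sym (trans p (cong proj₁ eq))) hit)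

  vertexSlot≢two : ∀ j x → vertexSlot j ≢ (x , two)
  vertexSlot≢two j x eq with colour (next j) ≟ᶠ colour j | cong proj₂ eq
  ... | yes _ | ()
  ... | no _ | ()

  edgeSlot≢edgeColour : ∀ i e b → edgeSlot i ≢ (c (inj₂ e) , b)
  edgeSlot≢edgeColour i e b eq = edgeColour≢edgeClass (cycleEdge i) e (sym (cong proj₁ eq))

  EmptySlots : Set
  EmptySlots = Σ (Fin 3 → Fin m × Fin 3) λ s →
    Injective _≡_ _≡_ s × (∀ j b → vertexSlot j ≢ s b) × (∀ i b → edgeSlot i ≢ s b)

  w : Fin m
  w = c (inj₂ (cycleEdge zero))

  emptySlots-uncoloured : (∀ j → colour j ≢ w) → EmptySlots
  emptySlots-uncoloured w-unused =
    (w ,_) , cong proj₂ , (λ j b eq → w-unused j (cong proj₁ eq)) , (λ i → edgeSlot≢edgeColour i (cycleEdge zero))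

  -- The subdivision vertex next to a vertex of colour w has a second edge colour z.
  emptySlots-coloured : ∀ j₀ → colour j₀ ≡ w → EmptySlots
  emptySlots-coloured j₀ j₀-coloured-w = slot , injective₃ (λ ()) (w≢z ∘ cong proj₁) (w≢z ∘ cong proj₁) ,
                                         vertexSlot≢slot , edgeSlot≢slot
    where
    z : Fin m
    z = c (inj₂ (cycleEdge j₀))

    w≢z : w ≢ z
    w≢z w≡z = proper _ _ (edgeBetween-endˡ cyc _ _) (sym (trans j₀-coloured-w w≡z))

    slot : Fin 3 → Fin m × Fin 3
    slot zero = w , one
    slot one = w , two
    slot two = z , one

    vertexSlot≢slot : ∀ j b → vertexSlot j ≢ slot b
    vertexSlot≢slot j zero = vertexSlot≢edgeColour j (cycleEdge zero)
    vertexSlot≢slot j one = vertexSlot≢two j w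
    vertexSlot≢slot j two = vertexSlot≢edgeColour j (cycleEdge j₀)

    edgeSlot≢slot : ∀ i b → edgeSlot i ≢ slot b
    edgeSlot≢slot i zero = edgeSlot≢edgeColour i (cycleEdge zero) one
    edgeSlot≢slot i one = edgeSlot≢edgeColour i (cycleEdge zero) two
    edgeSlot≢slot i two = edgeSlot≢edgeColour i (cycleEdge j₀) one

  emptySlots : EmptySlots
  emptySlots with any? (λ j → colour j ≟ᶠ w)
  ... | yes (j₀ , j₀-coloured-w) = emptySlots-coloured j₀ j₀-coloured-w
  ... | no ¬coloured = emptySlots-uncoloured (λ j eq → ¬coloured (j , eq))

  slotCount : suc k + (suc k + 3) ≤ m * 3
  slotCount with emptySlots
  ... | empty , empty-injective , vertexSlot≢empty , edgeSlot≢empty =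
    ↣⇒≤ ((↔-refl ⊎-↔ +↔⊎) ↔-∘ +↔⊎) (mk↣ slot-injective) *↔×
    where
    slot-injective : Injective _≡_ _≡_ [ vertexSlot , [ edgeSlot , empty ] ]
    slot-injective = [,]-injective vertexSlot-injective
      ([,]-injective edgeSlot-injective empty-injective edgeSlot≢empty)
      (λ j → [ vertexSlot≢edgeSlot j , vertexSlot≢empty j ])

pair : ∀ {A : Set} → A → A → Fin 2 → A
pair x _ zero = x
pair _ y one = y

distinct-pair : ∀ {m} (h : Fin 3 → Fin m) → ¬ (h zero ≡ h one × h one ≡ h two) → ∃ λ a → ∃ λ b → h a ≢ h b
distinct-pair h ¬constant with h zero ≟ᶠ h one | h one ≟ᶠ h two
... | no h₀≢h₁ | _ = zero , one , h₀≢h₁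
... | yes _ | no h₁≢h₂ = one , two , h₁≢h₂
... | yes h₀≡h₁ | yes h₁≡h₂ = ⊥-elim (¬constant (h₀≡h₁ , h₁≡h₂))

no-edge-through-three : ∀ {a b : Fin 3} → zero ≡ a ⊎ zero ≡ b → one ≡ a ⊎ one ≡ b → two ≡ a ⊎ two ≡ b → ⊥
no-edge-through-three (inj₁ refl) (inj₂ refl) (inj₁ ())
no-edge-through-three (inj₁ refl) (inj₂ refl) (inj₂ ())
no-edge-through-three (inj₂ refl) (inj₁ refl) (inj₁ ())
no-edge-through-three (inj₂ refl) (inj₁ refl) (inj₂ ())

triangle-complete : ∀ (j l : Fin 3) → j ≢ l → cycleAdj 3 j l ≡ true
triangle-complete = from-yes (all? λ j → all? λ l → ¬? (j ≟ᶠ l) →-dec (cycleAdj 3 j l ≟ᵇ true))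

module TriangleBound {m} (cyc : Graph 3) (hyp : ∀ i j → adj cyc i j ≡ cycleAdj 3 i j)
                     (c : CVertex cyc → Fin m) (tdc : IsTDC (CAdj cyc) m c) where
  open CycleTDC (s≤s z≤n) cyc hyp c tdc

  vertexClass : Fin 3 → Fin m
  vertexClass j = dominated (inj₁ j)

  colour≢vertexClass : ∀ j l → colour l ≢ vertexClass j
  colour≢vertexClass j l hit with dominated-adj hit
  ... | j≢l , nonadj with trans (sym nonadj) (trans (hyp j l) (triangle-complete j l j≢l))
  ...   | ()

  edgeClass≢vertexClass : ∀ i j → edgeClass i ≢ vertexClass j
  edgeClass≢vertexClass i j eq = let (l , hit) = edgeClass-inhabited i in colour≢vertexClass j l (trans hit eq)

  edgeClass-nonconstant : ¬ (edgeClass zero ≡ edgeClass one × edgeClass one ≡ edgeClass two)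
  edgeClass-nonconstant (e₀₁ , e₁₂) with edgeClass-inhabited zero
  ... | l , hit with edgeClass-member zero hit
  ...   | inj₁ refl with edgeClass-member one (trans hit e₀₁)
  ...     | inj₁ ()
  ...     | inj₂ ()
  edgeClass-nonconstant (e₀₁ , e₁₂) | l , hit | inj₂ refl with edgeClass-member two (trans hit (trans e₀₁ e₁₂))
  ...     | inj₁ ()
  ...     | inj₂ ()

  vertexClass-nonconstant : ¬ (vertexClass zero ≡ vertexClass one × vertexClass one ≡ vertexClass two)
  vertexClass-nonconstant (v₀₁ , v₁₂) with dominated-inhabited (inj₁ zero)
  ... | inj₁ l , hit = colour≢vertexClass zero l hit
  ... | inj₂ e , hit = no-edge-through-three
    (dominated-adj hit) (dominated-adj (trans hit v₀₁)) (dominated-adj (trans hit (trans v₀₁ v₁₂)))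

  four≤m : 4 ≤ m
  four≤m with distinct-pair edgeClass edgeClass-nonconstant | distinct-pair vertexClass vertexClass-nonconstant
  ... | a , b , a≢b | a′ , b′ , a′≢b′ = ↣⇒≤ +↔⊎ (mk↣ classes-injective) ↔-refl
    where
    classes-injective : Injective _≡_ _≡_ [ edgeClass ∘ pair a b , vertexClass ∘ pair a′ b′ ]
    classes-injective = [,]-injective (injective₂ a≢b) (injective₂ a′≢b′)
      (λ x y → edgeClass≢vertexClass (pair a b x) (pair a′ b′ y))

-- Upper bounds

record IsCentralColouring {n K} (A : Fin n → Fin n → Bool)
                          (vc : Fin n → Fin K) (ec : Fin n → Fin n → Fin K) : Set where
  field
    vertex-proper : ∀ i j → i ≢ j → A i j ≡ false → vc i ≢ vc j
    end-proper    : ∀ a b → toℕ a < toℕ b → A a b ≡ true → vc a ≢ ec a b × vc b ≢ ec a b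
    onto          : ∀ x → (∃ λ i → vc i ≡ x) ⊎ (∃ λ a → ∃ λ b → toℕ a < toℕ b × A a b ≡ true × ec a b ≡ x)
    vertex-dominates : ∀ j → ∃ λ x → (∀ l → vc l ≡ x → l ≢ j × A j l ≡ false) ×
                         (∀ a b → toℕ a < toℕ b → A a b ≡ true → ec a b ≡ x → j ≡ a ⊎ j ≡ b)
    edge-dominates : ∀ a b → toℕ a < toℕ b → A a b ≡ true → ∃ λ x → (∀ l → vc l ≡ x → l ≡ a ⊎ l ≡ b) ×
                       (∀ a′ b′ → toℕ a′ < toℕ b′ → A a′ b′ ≡ true → ec a′ b′ ≢ x)

isCentralColouring? : ∀ {n K} (A : Fin n → Fin n → Bool) (vc : Fin n → Fin K) (ec : Fin n → Fin n → Fin K) →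
  Dec (IsCentralColouring A vc ec)
isCentralColouring? A vc ec =
  map′ (λ (p , q , r , s , t) → record
          { vertex-proper = p ; end-proper = q ; onto = r ; vertex-dominates = s ; edge-dominates = t })
       (λ ic → let open IsCentralColouring ic in vertex-proper , end-proper , onto , vertex-dominates , edge-dominates)
       (vertex-proper? ×-dec end-proper? ×-dec onto? ×-dec vertex-dominates? ×-dec edge-dominates?)
  where
  vertex-proper? = all? λ i → all? λ j → ¬? (i ≟ᶠ j) →-dec (A i j ≟ᵇ false) →-dec ¬? (vc i ≟ᶠ vc j)
  end-proper? = all? λ a → all? λ b → (toℕ a <? toℕ b) →-dec (A a b ≟ᵇ true) →-dec
    (¬? (vc a ≟ᶠ ec a b) ×-dec ¬? (vc b ≟ᶠ ec a b))
  onto? = all? λ x → any? (λ i → vc i ≟ᶠ x) ⊎-dec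
    any? (λ a → any? λ b → (toℕ a <? toℕ b) ×-dec (A a b ≟ᵇ true) ×-dec (ec a b ≟ᶠ x))
  vertex-dominates? = all? λ j → any? λ x →
    (all? λ l → (vc l ≟ᶠ x) →-dec (¬? (l ≟ᶠ j) ×-dec (A j l ≟ᵇ false))) ×-dec
    (all? λ a → all? λ b → (toℕ a <? toℕ b) →-dec (A a b ≟ᵇ true) →-dec (ec a b ≟ᶠ x) →-dec ((j ≟ᶠ a) ⊎-dec (j ≟ᶠ b)))
  edge-dominates? = all? λ a → all? λ b → (toℕ a <? toℕ b) →-dec (A a b ≟ᵇ true) →-dec
    (any? λ x → (all? λ l → (vc l ≟ᶠ x) →-dec ((l ≟ᶠ a) ⊎-dec (l ≟ᶠ b))) ×-dec
      (all? λ a′ → all? λ b′ → (toℕ a′ <? toℕ b′) →-dec (A a′ b′ ≟ᵇ true) →-dec ¬? (ec a′ b′ ≟ᶠ x)))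

centralColouring⇒TDC : ∀ {n K} {A : Fin n → Fin n → Bool} {vc : Fin n → Fin K} {ec : Fin n → Fin n → Fin K} →
  (G : Graph n) → (∀ i j → adj G i j ≡ A i j) → IsCentralColouring A vc ec → HasTDC (CAdj G) K
centralColouring⇒TDC {A = A} {vc} {ec} G adj≡A ic = colouring , surjective , proper , dominates
  where
  open IsCentralColouring ic

  colouring : CVertex G → Fin _
  colouring (inj₁ i) = vc i
  colouring (inj₂ ((a , b) , _)) = ec a b

  edge : ∀ {a b} → adj G a b ≡ true → A a b ≡ true
  edge {a} {b} ab = trans (sym (adj≡A a b)) ab

  surjective : ∀ x → ∃ λ v → ∀ {u} → u ≡ v → colouring u ≡ x
  surjective x with onto x
  ... | inj₁ (i , hit) = inj₁ i , λ { refl → hit }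
  ... | inj₂ (a , b , a<b , ab , hit) = inj₂ ((a , b) , a<b , trans (adj≡A a b) ab) , λ { refl → hit }

  proper : ∀ u v → CAdj G u v → colouring u ≢ colouring v
  proper (inj₁ i) (inj₁ j) (i≢j , nonadj) = vertex-proper i j i≢j (trans (sym (adj≡A i j)) nonadj)
  proper (inj₁ _) (inj₂ ((a , b) , a<b , ab)) (inj₁ refl) = proj₁ (end-proper a b a<b (edge ab))
  proper (inj₁ _) (inj₂ ((a , b) , a<b , ab)) (inj₂ refl) = proj₂ (end-proper a b a<b (edge ab))
  proper (inj₂ ((a , b) , a<b , ab)) (inj₁ _) (inj₁ refl) = proj₁ (end-proper a b a<b (edge ab)) ∘ sym
  proper (inj₂ ((a , b) , a<b , ab)) (inj₁ _) (inj₂ refl) = proj₂ (end-proper a b a<b (edge ab)) ∘ sym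

  dominates : ∀ v → ∃ λ x → ∀ u → colouring u ≡ x → CAdj G v u
  dominates (inj₁ j) with vertex-dominates j
  ... | x , vertices , edges = x , λ where
    (inj₁ l) hit → let (l≢j , nonadj) = vertices l hit in l≢j ∘ sym , trans (adj≡A j l) nonadj
    (inj₂ ((a , b) , a<b , ab)) hit → edges a b a<b (edge ab) hit
  dominates (inj₂ ((a , b) , a<b , ab)) with edge-dominates a b a<b (edge ab)
  ... | x , vertices , edges = x , λ where
    (inj₁ l) hit → vertices l hit
    (inj₂ ((a′ , b′) , a′<b′ , a′b′)) hit → ⊥-elim (edges a′ b′ a′<b′ (edge a′b′) hit)

pattern three = suc two
pattern four = suc three

smallCycleTDC₃ : (cyc : Graph 3) → (∀ i j → adj cyc i j ≡ cycleAdj 3 i j) → HasTDC (CAdj cyc) 4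
smallCycleTDC₃ cyc hyp = centralColouring⇒TDC cyc hyp (from-yes (isCentralColouring? (cycleAdj 3) vc ec))
  where
  vc : Fin 3 → Fin 4
  vc two = one
  vc _ = zero
  ec : Fin 3 → Fin 3 → Fin 4
  ec one two = three
  ec _ _ = two

smallCycleTDC₄ : (cyc : Graph 4) → (∀ i j → adj cyc i j ≡ cycleAdj 4 i j) → HasTDC (CAdj cyc) 4
smallCycleTDC₄ cyc hyp = centralColouring⇒TDC cyc hyp (from-yes (isCentralColouring? (cycleAdj 4) vc ec))
  where
  vc : Fin 4 → Fin 4
  vc i = i
  ec : Fin 4 → Fin 4 → Fin 4
  ec one _ = zero
  ec two _ = zero
  ec _ _ = two

smallCycleTDC₅ : (cyc : Graph 5) → (∀ i j → adj cyc i j ≡ cycleAdj 5 i j) → HasTDC (CAdj cyc) 5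
smallCycleTDC₅ cyc hyp = centralColouring⇒TDC cyc hyp (from-yes (isCentralColouring? (cycleAdj 5) vc ec))
  where
  vc : Fin 5 → Fin 5
  vc zero = zero
  vc one = one
  vc two = one
  vc three = two
  vc four = three
  ec : Fin 5 → Fin 5 → Fin 5
  ec _ _ = four

-- twoThirds k = ⌊(2k + 1) / 3⌋, i.e. 0, 1, 1, 2, 3, 3, 4, 5, 5, …
twoThirds : ℕ → ℕ
twoThirds 0 = 0
twoThirds 1 = 1
twoThirds 2 = 1
twoThirds (suc (suc (suc j))) = suc (suc (twoThirds j))

twoThirds-step : ∀ j → twoThirds (suc j) ≡ twoThirds j ⊎ twoThirds (suc j) ≡ suc (twoThirds j)
twoThirds-step 0 = inj₂ refl
twoThirds-step 1 = inj₁ refl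
twoThirds-step 2 = inj₂ refl
twoThirds-step (suc (suc (suc j))) = Sum.map (cong (2 +_)) (cong (2 +_)) (twoThirds-step j)

twoThirds-mono : ∀ {j l} → j ≤ l → twoThirds j ≤ twoThirds l
twoThirds-mono {j} {l} j≤l with m≤n⇒m<n∨m≡n j≤l
... | inj₂ refl = ≤-refl
... | inj₁ (s≤s j≤l′) = ≤-trans (twoThirds-mono j≤l′) (step-mono _)
  where
  step-mono : ∀ i → twoThirds i ≤ twoThirds (suc i)
  step-mono i with twoThirds-step i
  ... | inj₁ same = ≤-reflexive (sym same)
  ... | inj₂ up = ≤-trans (n≤1+n _) (≤-reflexive (sym up))

twoThirds-onto : ∀ p {x} → x ≤ twoThirds p → ∃ λ j → j ≤ p × twoThirds j ≡ x
twoThirds-onto zero z≤n = 0 , z≤n , refl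
twoThirds-onto (suc p) {x} x≤ with m≤n⇒m<n∨m≡n x≤ | twoThirds-step p
... | inj₂ refl | _ = suc p , ≤-refl , refl
... | inj₁ x< | inj₁ same = let (j , j≤p , hit) = twoThirds-onto p (<⇒≤ (subst (x <_) same x<)) in j , m≤n⇒m≤1+n j≤p , hit
... | inj₁ x< | inj₂ up = let (j , j≤p , hit) = twoThirds-onto p (≤-pred (subst (x <_) up x<)) in j , m≤n⇒m≤1+n j≤p , hit

twoThirds-fibre : ∀ j l → twoThirds j ≡ twoThirds l → j ≡ l ⊎ l ≡ suc j ⊎ j ≡ suc l
twoThirds-fibre 0 0 _ = inj₁ refl
twoThirds-fibre 1 1 _ = inj₁ refl
twoThirds-fibre 1 2 _ = inj₂ (inj₁ refl)
twoThirds-fibre 2 1 _ = inj₂ (inj₂ refl)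
twoThirds-fibre 2 2 _ = inj₁ refl
twoThirds-fibre (suc (suc (suc j))) (suc (suc (suc l))) eq =
  Sum.map (cong (3 +_)) (Sum.map (cong (3 +_)) (cong (3 +_))) (twoThirds-fibre j l (suc-injective (suc-injective eq)))
twoThirds-fibre 0 (suc (suc (suc _))) ()
twoThirds-fibre 1 (suc (suc (suc _))) ()
twoThirds-fibre 2 (suc (suc (suc _))) ()
twoThirds-fibre (suc (suc (suc _))) 0 ()
twoThirds-fibre (suc (suc (suc _))) 1 ()
twoThirds-fibre (suc (suc (suc _))) 2 ()

twoThirds-spacing : ∀ j → twoThirds (1 + j) ≡ twoThirds j → twoThirds (3 + j) ≢ twoThirds (2 + j)
twoThirds-spacing 1 _ ()
twoThirds-spacing (suc (suc (suc j))) same =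
  twoThirds-spacing j (suc-injective (suc-injective same)) ∘ suc-injective ∘ suc-injective

twoThirds≡0 : ∀ j → twoThirds j ≡ 0 → j ≡ 0
twoThirds≡0 0 _ = refl
twoThirds≡0 1 ()
twoThirds≡0 2 ()
twoThirds≡0 (suc (suc (suc _))) ()

twoThirds≡2 : ∀ j → twoThirds j ≡ 2 → j ≡ 3
twoThirds≡2 (suc (suc (suc j))) eq = cong (3 +_) (twoThirds≡0 j (suc-injective (suc-injective eq)))

3*twoThirds≤ : ∀ k → 3 * twoThirds k ≤ 2 * k + 1
3*twoThirds≤ 0 = z≤n
3*twoThirds≤ 1 = ≤-refl
3*twoThirds≤ 2 = s≤s (s≤s (s≤s z≤n))
3*twoThirds≤ (suc (suc (suc k))) = begin
  3 * (2 + twoThirds k) ≡⟨ *-distribˡ-+ 3 2 (twoThirds k) ⟩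
  6 + 3 * twoThirds k   ≤⟨ +-monoʳ-≤ 6 (3*twoThirds≤ k) ⟩
  6 + (2 * k + 1)       ≡⟨ cong (_+ 1) (sym (*-distribˡ-+ 2 3 k)) ⟩
  2 * (3 + k) + 1       ∎
  where open ≤-Reasoning

far-from-0 : ∀ {n a} → a ≢ 0 → a ≢ 1 → suc a ≢ n → ¬ CycleNeighbours n a 0
far-from-0 _ _ _ (inj₁ (step ()))
far-from-0 _ _ 1+a≢n (inj₁ (wrap 1+a≡n _)) = 1+a≢n 1+a≡n
far-from-0 _ a≢1 _ (inj₂ (step a≡1)) = a≢1 a≡1
far-from-0 a≢0 _ _ (inj₂ (wrap _ a≡0)) = a≢0 a≡0

far-from-3 : ∀ {p′ a} → a ≡ 0 ⊎ a ≡ 1 ⊎ a ≡ 5 + p′ → 3 ≢ a × ¬ CycleNeighbours (6 + p′) a 3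
far-from-3 (inj₁ refl) = (λ ()) , λ { (inj₁ (step ())) ; (inj₂ (step ())) ; (inj₂ (wrap () _)) }
far-from-3 (inj₂ (inj₁ refl)) = (λ ()) , λ { (inj₁ (step ())) ; (inj₂ (step ())) ; (inj₂ (wrap () _)) }
far-from-3 (inj₂ (inj₂ refl)) =
  (λ ()) , λ { (inj₁ (step ())) ; (inj₁ (wrap _ ())) ; (inj₂ (step ())) ; (inj₂ (wrap () _)) }

module LargeCycleColouring (p′ : ℕ) where
  p : ℕ
  p = 5 + p′

  K : ℕ
  K = 2 + twoThirds p

  vc : Fin (suc p) → Fin K
  vc j = fromℕ< (s≤s (m≤n⇒m≤1+n (twoThirds-mono (≤-pred (toℕ<n j)))))

  ec : Fin (suc p) → Fin (suc p) → Fin K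
  ec _ _ = fromℕ (suc (twoThirds p))

  toℕ-vc : ∀ j → toℕ (vc j) ≡ twoThirds (toℕ j)
  toℕ-vc j = toℕ-fromℕ< _

  vc≡⇒twoThirds≡ : ∀ {i j} → vc i ≡ vc j → twoThirds (toℕ i) ≡ twoThirds (toℕ j)
  vc≡⇒twoThirds≡ {i} {j} eq = trans (sym (toℕ-vc i)) (trans (cong toℕ eq) (toℕ-vc j))

  vc≢ec : ∀ j a b → vc j ≢ ec a b
  vc≢ec j _ _ eq = <⇒≢ (s≤s (twoThirds-mono (≤-pred (toℕ<n j))))
    (trans (sym (toℕ-vc j)) (trans (cong toℕ eq) (toℕ-fromℕ _)))

  vertex-proper : ∀ i j → i ≢ j → cycleAdj (suc p) i j ≡ false → vc i ≢ vc j
  vertex-proper i j i≢j nonadj same with twoThirds-fibre (toℕ i) (toℕ j) (vc≡⇒twoThirds≡ same)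
  ... | inj₁ i≡j = i≢j (toℕ-injective i≡j)
  ... | inj₂ next = case trans (sym nonadj) (CycleNeighbours⇒cycleAdj _ i j (Sum.map step step next)) of λ ()

  onto : ∀ x → (∃ λ i → vc i ≡ x) ⊎
                (∃ λ a → ∃ λ b → toℕ a < toℕ b × cycleAdj (suc p) a b ≡ true × ec a b ≡ x)
  onto x with toℕ x ≟ℕ suc (twoThirds p)
  ... | yes x≡top = inj₂ (zero , one , s≤s z≤n , refl , toℕ-injective (trans (toℕ-fromℕ _) (sym x≡top)))
  ... | no x≢top = let (j , j≤p , hit) = twoThirds-onto p (≤-pred (≤∧≢⇒< (≤-pred (toℕ<n x)) x≢top)) in
    inj₁ (fromℕ< (s≤s j≤p) , toℕ-injective (trans (toℕ-vc _) (trans (cong twoThirds (toℕ-fromℕ< _)) hit)))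

  class-zero : ∀ {l} → vc l ≡ vc zero → l ≡ zero
  class-zero hit = toℕ-injective (twoThirds≡0 _ (vc≡⇒twoThirds≡ {j = zero} hit))

  class-three : ∀ {l} → vc l ≡ vc three → l ≡ three
  class-three hit = toℕ-injective (twoThirds≡2 _ (vc≡⇒twoThirds≡ {j = three} hit))

  VertexDominates : Fin (suc p) → Fin K → Set
  VertexDominates j x = (∀ l → vc l ≡ x → l ≢ j × cycleAdj (suc p) j l ≡ false) ×
                        (∀ a b → toℕ a < toℕ b → cycleAdj (suc p) a b ≡ true → ec a b ≡ x → j ≡ a ⊎ j ≡ b)

  dominates-singleton : ∀ j t → (∀ {l} → vc l ≡ vc t → l ≡ t) → toℕ t ≢ toℕ j →
    ¬ CycleNeighbours (suc p) (toℕ j) (toℕ t) → VertexDominates j (vc t)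
  dominates-singleton j t singleton t≢j far =
    (λ l hit → case singleton hit of λ { refl → t≢j ∘ cong toℕ , ¬CycleNeighbours⇒cycleAdj _ j t far }) ,
    (λ a b _ _ ec≡vc → ⊥-elim (vc≢ec t a b (sym ec≡vc)))

  vertex-dominates : ∀ j → ∃ (VertexDominates j)
  vertex-dominates j with toℕ j ≟ℕ 0 | toℕ j ≟ℕ 1 | toℕ j ≟ℕ p
  ... | no j≢0 | no j≢1 | no j≢p =
    vc zero , dominates-singleton j zero class-zero (j≢0 ∘ sym) (far-from-0 j≢0 j≢1 (j≢p ∘ suc-injective))
  ... | yes j≡0 | _ | _ = vc three , uncurry (dominates-singleton j three class-three) (far-from-3 (inj₁ j≡0))
  ... | no _ | yes j≡1 | _ = vc three , uncurry (dominates-singleton j three class-three) (far-from-3 (inj₂ (inj₁ j≡1)))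
  ... | no _ | no _ | yes j≡p = vc three , uncurry (dominates-singleton j three class-three) (far-from-3 (inj₂ (inj₂ j≡p)))

  EdgeDominates : Fin (suc p) → Fin (suc p) → Fin K → Set
  EdgeDominates a b x = (∀ l → vc l ≡ x → l ≡ a ⊎ l ≡ b) ×
                        (∀ a′ b′ → toℕ a′ < toℕ b′ → cycleAdj (suc p) a′ b′ ≡ true → ec a′ b′ ≢ x)

  dominates-vertexClass : ∀ a b t → (∀ l → vc l ≡ vc t → l ≡ a ⊎ l ≡ b) → EdgeDominates a b (vc t)
  dominates-vertexClass a b t within = within , λ a′ b′ _ _ ec≡vc → vc≢ec t a′ b′ (sym ec≡vc)

  -- On the edge {a , a + 1} the class of a + 1 works unless a + 2 shares its colour, and then
  -- the class of a works, because a - 1 cannot share the colour of a as well.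
  consecutive-dominates : ∀ a b → toℕ b ≡ suc (toℕ a) → ∃ (EdgeDominates a b)
  consecutive-dominates a b b≡1+a with twoThirds (2 + toℕ a) ≟ℕ twoThirds (1 + toℕ a)
  ... | no a+2∉ = vc b , dominates-vertexClass a b b λ l hit →
    case twoThirds-fibre (toℕ l) (toℕ b) (vc≡⇒twoThirds≡ hit) of λ where
      (inj₁ l≡b) → inj₂ (toℕ-injective l≡b)
      (inj₂ (inj₁ b≡1+l)) → inj₁ (toℕ-injective (suc-injective (trans (sym b≡1+l) b≡1+a)))
      (inj₂ (inj₂ l≡1+b)) → ⊥-elim (a+2∉ (subst (λ t → twoThirds (suc t) ≡ twoThirds t) b≡1+a
                               (trans (cong twoThirds (sym l≡1+b)) (vc≡⇒twoThirds≡ hit))))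
  ... | yes a+2∈ = vc a , dominates-vertexClass a b a λ l hit →
    case twoThirds-fibre (toℕ l) (toℕ a) (vc≡⇒twoThirds≡ hit) of λ where
      (inj₁ l≡a) → inj₁ (toℕ-injective l≡a)
      (inj₂ (inj₁ a≡1+l)) → ⊥-elim (twoThirds-spacing (toℕ l)
        (sym (trans (vc≡⇒twoThirds≡ hit) (cong twoThirds a≡1+l)))
        (subst (λ t → twoThirds (2 + t) ≡ twoThirds (1 + t)) a≡1+l a+2∈))
      (inj₂ (inj₂ l≡1+a)) → inj₂ (toℕ-injective (trans l≡1+a (sym b≡1+a)))

  edge-dominates : ∀ a b → toℕ a < toℕ b → cycleAdj (suc p) a b ≡ true → ∃ (EdgeDominates a b)
  edge-dominates a b a<b ab with cycleAdj⇒CycleNeighbours _ a b ab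
  ... | inj₁ (step b≡1+a) = consecutive-dominates a b b≡1+a
  ... | inj₁ (wrap _ b≡0) = ⊥-elim (n≮0 (subst (toℕ a <_) b≡0 a<b))
  ... | inj₂ (step a≡1+b) = ⊥-elim (<-asym a<b (subst (toℕ b <_) (sym a≡1+b) (n<1+n (toℕ b))))
  ... | inj₂ (wrap _ a≡0) = vc a , dominates-vertexClass a b a λ l hit →
    inj₁ (toℕ-injective (trans (twoThirds≡0 _ (trans (vc≡⇒twoThirds≡ hit) (cong twoThirds a≡0))) (sym a≡0)))

  colouring : IsCentralColouring (cycleAdj (suc p)) vc ec
  colouring = record
    { vertex-proper = vertex-proper
    ; end-proper = λ a b _ _ → vc≢ec a a b , vc≢ec b a b
    ; onto = onto
    ; vertex-dominates = vertex-dominates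
    ; edge-dominates = edge-dominates
    }

slotCount⇒bound : ∀ k m → suc k + (suc k + 3) ≤ m * 3 → 2 + twoThirds k ≤ m
slotCount⇒bound k m slots = ≤-pred (*-cancelˡ-< 3 (2 + twoThirds k) (suc m) (begin-strict
  3 * (2 + twoThirds k)   ≡⟨ *-distribˡ-+ 3 2 (twoThirds k) ⟩
  6 + 3 * twoThirds k     ≤⟨ +-monoʳ-≤ 6 (3*twoThirds≤ k) ⟩
  6 + (2 * k + 1)         <⟨ ≤-reflexive (rearrange k) ⟩
  suc k + (suc k + 3) + 3 ≤⟨ +-monoˡ-≤ 3 slots ⟩
  m * 3 + 3               ≡⟨ trans (+-comm (m * 3) 3) (*-comm (suc m) 3) ⟩
  3 * suc m               ∎))
  where
  open ≤-Reasoning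
  rearrange : ∀ k → suc (6 + (2 * k + 1)) ≡ suc k + (suc k + 3) + 3
  rearrange = solve-∀

two-thirds-of-3+ : ∀ n → 2 * (3 + n) / 3 ≡ 2 + 2 * n / 3
two-thirds-of-3+ n = trans (cong (_/ 3) (*-distribˡ-+ 2 3 n)) (+-distrib-/-∣ˡ (2 * n) {3} (divides 2 refl))

if-2+ : ∀ b x → (if b then 2 + x + 1 else 2 + x + 2) ≡ 2 + (if b then x + 1 else x + 2)
if-2+ true _ = refl
if-2+ false _ = refl

-- (7 + k) % 3 reduces to (4 + k) % 3, so both sides branch on the same condition.
expectedValue-+3 : ∀ k → expectedValue (7 + k) ≡ 2 + expectedValue (4 + k)
expectedValue-+3 k rewrite two-thirds-of-3+ (4 + k) = if-2+ _ (2 * (4 + k) / 3)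

expectedValue≡2+twoThirds : ∀ k → expectedValue (4 + k) ≡ 2 + twoThirds (3 + k)
expectedValue≡2+twoThirds 0 = refl
expectedValue≡2+twoThirds 1 = refl
expectedValue≡2+twoThirds 2 = refl
expectedValue≡2+twoThirds (suc (suc (suc k))) =
  trans (expectedValue-+3 k) (cong (2 +_) (expectedValue≡2+twoThirds k))

lowerBound : ∀ k → 3 ≤ k → (cyc : Graph (suc k)) → (∀ i j → adj cyc i j ≡ cycleAdj (suc k) i j) →
  ∀ m → HasTDC (CAdj cyc) m → 2 + twoThirds k ≤ m
lowerBound k 3≤k cyc hyp m (c , tdc) = slotCount⇒bound k m (SlotCounting.slotCount 3≤k cyc hyp c tdc)

upperBound : ∀ k → (cyc : Graph (4 + k)) → (∀ i j → adj cyc i j ≡ cycleAdj (4 + k) i j) →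
  HasTDC (CAdj cyc) (2 + twoThirds (3 + k))
upperBound 0 = smallCycleTDC₄
upperBound 1 = smallCycleTDC₅
upperBound (suc (suc p′)) cyc hyp = centralColouring⇒TDC cyc hyp (LargeCycleColouring.colouring p′)

proposition5p2 : (n : ℕ) → 3 ≤ n →
    (cyc : Graph n) → (∀ i j → adj cyc i j ≡ cycleAdj n i j) →
    TotalDomChromaticNumberIs (CAdj cyc) (expectedValue n)
proposition5p2 1 (s≤s ())
proposition5p2 2 (s≤s (s≤s ()))
proposition5p2 3 _ cyc hyp = smallCycleTDC₃ cyc hyp , λ m (c , tdc) → TriangleBound.four≤m cyc hyp c tdc
proposition5p2 (suc (suc (suc (suc k)))) _ cyc hyp rewrite expectedValue≡2+twoThirds k =
  upperBound k cyc hyp , lowerBound (3 + k) (s≤s (s≤s (s≤s z≤n))) cyc hyp
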